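{- Let $\Gamma_1,\dots,\Gamma_n,\Delta_1,\dots,\Delta_n$ be finite multisets of formulae, $A,B$ formulae, $a$ a parameter, and $k_1,\dots,k_n\ge 0$ integers with $\sum_{i=1}^n k_i\ge 1$; write $C^{k}$ for $k$ copies of $C$. Then in $\mathsf{LNIF}$: (i) if $\Gamma_1,(A\land B)^{k_1}\vdash\Delta_1/\!/\cdots/\!/\Gamma_n,(A\land B)^{k_n}\vdash\Delta_n$ is derivable, then so is $\Gamma_1,A^{k_1},B^{k_1}\vdash\Delta_1/\!/\cdots/\!/\Gamma_n,A^{k_n},B^{k_n}\vdash\Delta_n$; (ii) if $\Gamma_1,(A\lor B)^{k_1}\vdash\Delta_1/\!/\cdots/\!/\Gamma_n,(A\lor B)^{k_n}\vdash\Delta_n$ is derivable, then so are $\Gamma_1,A^{k_1}\vdash\Delta_1/\!/\cdots/\!/\Gamma_n,A^{k_n}\vdash\Delta_n$ and $\Gamma_1,B^{k_1}\vdash\Delta_1/\!/\cdots/\!/\Gamma_n,B^{k_n}\vdash\Delta_n$; (iii) if $\Gamma_1,(A\supset B)^{k_1}\vdash\Delta_1/\!/\cdots/\!/\Gamma_n,(A\supset B)^{k_n}\vdash\Delta_n$ is derivable, then so are $\Gamma_1,B^{k_1}\vdash\Delta_1/\!/\cdots/\!/\Gamma_n,B^{k_n}\vdash\Delta_n$ and $\Gamma_1,(A\supset B)^{k_1}\vdash\Delta_1,A^{k_1}/\!/\cdots/\!/\Gamma_n,(A\supset B)^{k_n}\vdash\Delta_n,A^{k_n}$; (iv) if $\Gamma_1,(\forall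 xA)^{k_1}\vdash\Delta_1/\!/\cdots/\!/\Gamma_n,(\forall xA)^{k_n}\vdash\Delta_n$ is derivable, then so is $\Gamma_1,A[a/x]^{k_1},(\forall xA)^{k_1}\vdash\Delta_1/\!/\cdots/\!/\Gamma_n,A[a/x]^{k_n},(\forall xA)^{k_n}\vdash\Delta_n$; (v) if $\Gamma_1,(\exists xA)^{k_1}\vdash\Delta_1/\!/\cdots/\!/\Gamma_n,(\exists xA)^{k_n}\vdash\Delta_n$ is derivable, then so is $\Gamma_1,A[a/x]^{k_1}\vdash\Delta_1/\!/\cdots/\!/\Gamma_n,A[a/x]^{k_n}\vdash\Delta_n$.
   Context: Formulae are first-order over $\bot,\land,\lor,\supset,\forall,\exists$; in sequents bound variables $x,y,\dots$ are distinct from parameters $a,b,\dots$, which occupy all free positions; $A[a/x]$ replaces free occurrences of $x$ by $a$; $p(\vec a)$ is an atomic formula with parameters $\vec a$. A linear nested sequent is $\Gamma_1\vdash\Delta_1 /\!/ \cdots /\!/ \Gamma_n\vdash\Delta_n$ ($n\ge1$), each $\Gamma_i,\Delta_i$ a finite, possibly empty, multiset of formulae (a component). In rule schemas, $\mathcal{G},\mathcal{H},\mathcal{F}$ denote possibly empty sequences of components. $\mathsf{LNIF}$ has the rules (from premise(s) infer conclusion): Initial: $(id_1)$ $\mathcal{G}/\!/\Gamma,p(\vec a)\vdash p(\vec a),\Delta/\!/\mathcal{H}$; $(id_2)$ $\mathcal{G}/\!/\Gamma_1,p(\vec a)\vdash\Delta_1/\!/\mathcal{H}/\!/\Gamma_2\vdash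 p(\vec a),\Delta_2/\!/\mathcal{F}$; $(\bot_l)$ $\mathcal{G}/\!/\Gamma,\bot\vdash\Delta/\!/\mathcal{H}$. $(\land_l)$: from $\mathcal{G}/\!/\Gamma,A,B\vdash\Delta/\!/\mathcal{H}$ infer $\mathcal{G}/\!/\Gamma,A\land B\vdash\Delta/\!/\mathcal{H}$. $(\lor_r)$: from $\mathcal{G}/\!/\Gamma\vdash\Delta,A,B/\!/\mathcal{H}$ infer $\mathcal{G}/\!/\Gamma\vdash\Delta,A\lor B/\!/\mathcal{H}$. $(\land_r)$: from $\mathcal{G}/\!/\Gamma\vdash\Delta,A/\!/\mathcal{H}$ and $\mathcal{G}/\!/\Gamma\vdash\Delta,B/\!/\mathcal{H}$ infer $\mathcal{G}/\!/\Gamma\vdash\Delta,A\land B/\!/\mathcal{H}$. $(\lor_l)$: from $\mathcal{G}/\!/\Gamma,A\vdash\Delta/\!/\mathcal{H}$ and $\mathcal{G}/\!/\Gamma,B\vdash\Delta/\!/\mathcal{H}$ infer $\mathcal{G}/\!/\Gamma,A\lor B\vdash\Delta/\!/\mathcal{H}$. $(\supset_{r1})$: from $\mathcal{G}/\!/\Gamma\vdash\Delta/\!/A\vdash B$ infer $\mathcal{G}/\!/\Gamma\vdash\Delta,A\supset B$. $(\supset_l)$: from $\mathcal{G}/\!/\Gamma,B\vdash\Delta/\!/\mathcal{H}$ and $\mathcal{G}/\!/\Gamma,A\supset B\vdash A,\Delta/\!/\mathcal{H}$ infer $\mathcal{G}/\!/\Gamma,A\supset B\vdash\Delta/\!/\mathcal{H}$.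 $(lift)$: from $\mathcal{G}/\!/\Gamma_1,A\vdash\Delta_1/\!/\Gamma_2,A\vdash\Delta_2/\!/\mathcal{H}$ infer $\mathcal{G}/\!/\Gamma_1,A\vdash\Delta_1/\!/\Gamma_2\vdash\Delta_2/\!/\mathcal{H}$. $(\forall_l)$: from $\mathcal{G}/\!/\Gamma,A[a/x],\forall xA\vdash\Delta/\!/\mathcal{H}$ infer $\mathcal{G}/\!/\Gamma,\forall xA\vdash\Delta/\!/\mathcal{H}$ ($a$ any parameter). $(\forall_{r1})$: from $\mathcal{G}/\!/\Gamma\vdash\Delta/\!/\ \vdash A[a/x]$ infer $\mathcal{G}/\!/\Gamma\vdash\Delta,\forall xA$. $(\exists_l)$: from $\mathcal{G}/\!/\Gamma,A[a/x]\vdash\Delta/\!/\mathcal{H}$ infer $\mathcal{G}/\!/\Gamma,\exists xA\vdash\Delta/\!/\mathcal{H}$. $(\exists_r)$: from $\mathcal{G}/\!/\Gamma\vdash A[a/x],\exists xA,\Delta/\!/\mathcal{H}$ infer $\mathcal{G}/\!/\Gamma\vdash\exists xA,\Delta/\!/\mathcal{H}$ ($a$ any parameter). $(\supset_{r2})$: from $\mathcal{G}/\!/\Gamma_1\vdash\Delta_1/\!/A\vdash B/\!/\Gamma_2\vdash\Delta_2/\!/\mathcal{H}$ and $\mathcal{G}/\!/\Gamma_1\vdash\Delta_1/\!/\Gamma_2\vdash\Delta_2,A\supset B/\!/\mathcal{H}$ infer $\mathcal{G}/\!/\Gamma_1\vdash\Delta_1,A\supset B/\!/\Gamma_2\vdash\Delta_2/\!/\mathcal{H}$.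 $(\forall_{r2})$: from $\mathcal{G}/\!/\Gamma_1\vdash\Delta_1/\!/\ \vdash A[a/x]/\!/\Gamma_2\vdash\Delta_2/\!/\mathcal{H}$ and $\mathcal{G}/\!/\Gamma_1\vdash\Delta_1/\!/\Gamma_2\vdash\Delta_2,\forall xA/\!/\mathcal{H}$ infer $\mathcal{G}/\!/\Gamma_1\vdash\Delta_1,\forall xA/\!/\Gamma_2\vdash\Delta_2/\!/\mathcal{H}$. In $(\forall_{r1}),(\exists_l),(\forall_{r2})$, $a$ is an eigenvariable (does not occur in the conclusion). -}

module Defs where

open import Data.Nat using (ℕ; _≟_)
open import Data.List using (List; []; _∷_; [_]; _++_; map; concatMap; filter; replicate)
open import Data.Nat.ListAction using (sum)
open import Data.List.Membership.Propositional using (_∉_)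
open import Data.List.Relation.Binary.Permutation.Propositional using (_↭_)
open import Data.List.Relation.Binary.Pointwise using (Pointwise)
open import Data.Product using (_×_; _,_)
open import Data.Bool using (if_then_else_)
open import Relation.Nullary using (¬?)
open import Relation.Nullary.Decidable using (⌊_⌋)
open import Relation.Binary.PropositionalEquality using (_≡_)

-- Terms and first-order formulae.
-- Bound variables (var x) and parameters (par a) are two disjoint sorts,
-- both named by natural numbers.

data Term : Set where
  var : ℕ → Term
  par : ℕ → Term

infixr 8 _∧_
infixr 7 _∨_
infixr 6 _⊃_

data Formula : Set where
  atom : ℕ → List Term → Formula
  ⊥'   : Formula
  _∧_  : Formula → Formula → Formula
  _∨_  : Formula → Formula → Formula
  _⊃_  : Formula → Formula → Formula
  all  : ℕ → Formula → Formula
  ex   : ℕ → Formula → Formula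

substT : ℕ → ℕ → Term → Term
substT x a (var y) = if ⌊ y ≟ x ⌋ then par a else var y
substT x a (par b) = par b

_[_/_] : Formula → ℕ → ℕ → Formula
atom p ts [ a / x ] = atom p (map (substT x a) ts)
⊥'        [ a / x ] = ⊥'
(A ∧ B)   [ a / x ] = (A [ a / x ]) ∧ (B [ a / x ])
(A ∨ B)   [ a / x ] = (A [ a / x ]) ∨ (B [ a / x ])
(A ⊃ B)   [ a / x ] = (A [ a / x ]) ⊃ (B [ a / x ])
all y A   [ a / x ] = if ⌊ y ≟ x ⌋ then all y A else all y (A [ a / x ])
ex y A    [ a / x ] = if ⌊ y ≟ x ⌋ then ex y A else ex y (A [ a / x ])

paramsT : Term → List ℕ
paramsT (var _) = []
paramsT (par a) = [ a ]

params : Formula → List ℕ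
params (atom p ts) = concatMap paramsT ts
params ⊥'          = []
params (A ∧ B)     = params A ++ params B
params (A ∨ B)     = params A ++ params B
params (A ⊃ B)     = params A ++ params B
params (all _ A)   = params A
params (ex _ A)    = params A

fvT : Term → List ℕ
fvT (var x) = [ x ]
fvT (par _) = []

fv : Formula → List ℕ
fv (atom p ts) = concatMap fvT ts
fv ⊥'          = []
fv (A ∧ B)     = fv A ++ fv B
fv (A ∨ B)     = fv A ++ fv B
fv (A ⊃ B)     = fv A ++ fv B
fv (all x A)   = filter (λ y → ¬? (y ≟ x)) (fv A)
fv (ex x A)    = filter (λ y → ¬? (y ≟ x)) (fv A)

-- Linear nested sequents.  Multisets are represented by lists; the
-- multiset reading is enforced by the exchange rule `ex-perm` below.

infix 3 _⊢_
record Comp : Set where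
  constructor _⊢_
  field
    ante : List Formula
    succ : List Formula
open Comp public

LNS : Set
LNS = List Comp

paramsC : Comp → List ℕ
paramsC (Γ ⊢ Δ) = concatMap params Γ ++ concatMap params Δ

paramsLNS : LNS → List ℕ
paramsLNS = concatMap paramsC

fvLNS : LNS → List ℕ
fvLNS = concatMap (λ c → concatMap fv (ante c) ++ concatMap fv (succ c))

ClosedLNS : LNS → Set
ClosedLNS G = fvLNS G ≡ []

_≈ₗ_ : LNS → LNS → Set
_≈ₗ_ = Pointwise (λ c d → (ante c ↭ ante d) × (succ c ↭ succ d))

data LNIF : LNS → Set where
  ex-perm : ∀ {G G'} → G ≈ₗ G' → LNIF G → LNIF G'
  id₁ : ∀ G H p ts Γ Δ →
        LNIF (G ++ (atom p ts ∷ Γ ⊢ atom p ts ∷ Δ) ∷ H)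
  id₂ : ∀ G H F p ts Γ₁ Δ₁ Γ₂ Δ₂ →
        LNIF (G ++ (atom p ts ∷ Γ₁ ⊢ Δ₁) ∷ H ++ (Γ₂ ⊢ atom p ts ∷ Δ₂) ∷ F)
  ⊥l  : ∀ G H Γ Δ → LNIF (G ++ (⊥' ∷ Γ ⊢ Δ) ∷ H)
  ∧l  : ∀ G H Γ Δ A B →
        LNIF (G ++ (A ∷ B ∷ Γ ⊢ Δ) ∷ H) →
        LNIF (G ++ (A ∧ B ∷ Γ ⊢ Δ) ∷ H)
  ∨r  : ∀ G H Γ Δ A B →
        LNIF (G ++ (Γ ⊢ A ∷ B ∷ Δ) ∷ H) →
        LNIF (G ++ (Γ ⊢ A ∨ B ∷ Δ) ∷ H)
  ∧r  : ∀ G H Γ Δ A B →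
        LNIF (G ++ (Γ ⊢ A ∷ Δ) ∷ H) →
        LNIF (G ++ (Γ ⊢ B ∷ Δ) ∷ H) →
        LNIF (G ++ (Γ ⊢ A ∧ B ∷ Δ) ∷ H)
  ∨l  : ∀ G H Γ Δ A B →
        LNIF (G ++ (A ∷ Γ ⊢ Δ) ∷ H) →
        LNIF (G ++ (B ∷ Γ ⊢ Δ) ∷ H) →
        LNIF (G ++ (A ∨ B ∷ Γ ⊢ Δ) ∷ H)
  ⊃r₁ : ∀ G Γ Δ A B →
        LNIF (G ++ (Γ ⊢ Δ) ∷ ([ A ] ⊢ [ B ]) ∷ []) →
        LNIF (G ++ (Γ ⊢ (A ⊃ B) ∷ Δ) ∷ [])
  ⊃l  : ∀ G H Γ Δ A B →
        LNIF (G ++ (B ∷ Γ ⊢ Δ) ∷ H) →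
        LNIF (G ++ ((A ⊃ B) ∷ Γ ⊢ A ∷ Δ) ∷ H) →
        LNIF (G ++ ((A ⊃ B) ∷ Γ ⊢ Δ) ∷ H)
  lift : ∀ G H Γ₁ Δ₁ Γ₂ Δ₂ A →
        LNIF (G ++ (A ∷ Γ₁ ⊢ Δ₁) ∷ (A ∷ Γ₂ ⊢ Δ₂) ∷ H) →
        LNIF (G ++ (A ∷ Γ₁ ⊢ Δ₁) ∷ (Γ₂ ⊢ Δ₂) ∷ H)
  ∀l  : ∀ G H Γ Δ x A a →
        LNIF (G ++ (A [ a / x ] ∷ all x A ∷ Γ ⊢ Δ) ∷ H) →
        LNIF (G ++ (all x A ∷ Γ ⊢ Δ) ∷ H)
  ∀r₁ : ∀ G Γ Δ x A a →
        a ∉ paramsLNS (G ++ (Γ ⊢ all x A ∷ Δ) ∷ []) →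
        LNIF (G ++ (Γ ⊢ Δ) ∷ ([] ⊢ [ A [ a / x ] ]) ∷ []) →
        LNIF (G ++ (Γ ⊢ all x A ∷ Δ) ∷ [])
  ∃l  : ∀ G H Γ Δ x A a →
        a ∉ paramsLNS (G ++ (ex x A ∷ Γ ⊢ Δ) ∷ H) →
        LNIF (G ++ (A [ a / x ] ∷ Γ ⊢ Δ) ∷ H) →
        LNIF (G ++ (ex x A ∷ Γ ⊢ Δ) ∷ H)
  ∃r  : ∀ G H Γ Δ x A a →
        LNIF (G ++ (Γ ⊢ A [ a / x ] ∷ ex x A ∷ Δ) ∷ H) →
        LNIF (G ++ (Γ ⊢ ex x A ∷ Δ) ∷ H)
  ⊃r₂ : ∀ G H Γ₁ Δ₁ Γ₂ Δ₂ A B →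
        LNIF (G ++ (Γ₁ ⊢ Δ₁) ∷ ([ A ] ⊢ [ B ]) ∷ (Γ₂ ⊢ Δ₂) ∷ H) →
        LNIF (G ++ (Γ₁ ⊢ Δ₁) ∷ (Γ₂ ⊢ (A ⊃ B) ∷ Δ₂) ∷ H) →
        LNIF (G ++ (Γ₁ ⊢ (A ⊃ B) ∷ Δ₁) ∷ (Γ₂ ⊢ Δ₂) ∷ H)
  ∀r₂ : ∀ G H Γ₁ Δ₁ Γ₂ Δ₂ x A a →
        a ∉ paramsLNS (G ++ (Γ₁ ⊢ all x A ∷ Δ₁) ∷ (Γ₂ ⊢ Δ₂) ∷ H) →
        LNIF (G ++ (Γ₁ ⊢ Δ₁) ∷ ([] ⊢ [ A [ a / x ] ]) ∷ (Γ₂ ⊢ Δ₂) ∷ H) →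
        LNIF (G ++ (Γ₁ ⊢ Δ₁) ∷ (Γ₂ ⊢ all x A ∷ Δ₂) ∷ H) →
        LNIF (G ++ (Γ₁ ⊢ all x A ∷ Δ₁) ∷ (Γ₂ ⊢ Δ₂) ∷ H)

-- Data of the lemma: a list of triples (Γᵢ , Δᵢ , kᵢ), i = 1..n.

Spec : Set
Spec = List (List Formula × List Formula × ℕ)

_^^_ : Formula → ℕ → List Formula
C ^^ k = replicate k C

build : (ℕ → List Formula) → (ℕ → List Formula) → Spec → LNS
build L R = map (λ { (Γ , Δ , k) → (Γ ++ L k ⊢ Δ ++ R k) })

none : ℕ → List Formula
none _ = []

totalK : Spec → ℕ
totalK S = sum (map (λ { (_ , _ , k) → k }) S)

module Submission where

-- All five parts are instances of one inversion argument, by induction on derivations.  The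
-- derivation is replayed on the new sequent, in which the displayed copies of P (A ∧ B, A ∨ B, ...)
-- are replaced by a list T of formulae from a premise of the left rule for P (see Inversion).
-- A left rule acting on a copy of P is dropped in favour of that premise, lift and ∀l acting on a
-- copy are replayed with T in place of P, and every other rule is replayed as it is.  For the
-- induction to go through, the replayed sequent is moreover renamed along a map σ on parameters
-- fixing those of P, and its succedents may be weakened.  The renaming lets every eigenvariable
-- be chosen fresh for the new sequent, and it turns the eigenvariable of an ∃l acting on a copy
-- of ∃xA into a.  Weakening alone gives the second claim of (iii).

open import Defs
open import Data.Nat using (ℕ; zero; suc; _≟_; _≤_; _<_; z<s)
open import Data.Nat.Properties using (n≮n)
open import Data.List using (List; []; _∷_; [_]; _++_; map; concat; concatMap; replicate)
open import Data.List.Properties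
  using (map-∘; map-cong; map-cong-local; map-id; map-++; ++-assoc; ++-identityʳ)
open import Data.List.Extrema.Nat using (max; xs≤max)
open import Data.List.Membership.Propositional using (_∈_; _∉_)
open import Data.List.Membership.Propositional.Properties
  using (∈-++⁺ˡ; ∈-++⁺ʳ; ∈-++⁻; ∈-∃++; ∈-map⁺; ∈-concatMap⁺)
open import Data.List.Relation.Unary.Any using (here; there)
open import Data.List.Relation.Unary.All as All using (All; []; _∷_)
open import Data.List.Relation.Unary.All.Properties using (¬Any⇒All¬; ++⁻; ++⁻ˡ)
open import Data.List.Relation.Binary.Permutation.Propositional
  using (_↭_; ↭-refl; ↭-sym; ↭-trans; ↭-reflexive; prep)
open import Data.List.Relation.Binary.Permutation.Propositional.Properties
  using (∈-resp-↭; All-resp-↭; ++⁺ˡ; ++⁺ʳ; shift; shifts; drop-∷; map⁺)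
open import Data.List.Relation.Binary.Pointwise as Pointwise using (Pointwise; []; _∷_; ++⁺)
open import Data.Product using (_×_; _,_; ∃-syntax)
open import Data.Sum using (inj₁; inj₂)
open import Data.Bool using (if_then_else_)
open import Function using (_∘_; id)
open import Relation.Nullary using (yes; no; contradiction)
open import Relation.Nullary.Decidable using (⌊_⌋)
open import Relation.Binary.PropositionalEquality
  using (_≡_; _≢_; refl; sym; trans; cong; cong₂; subst; module ≡-Reasoning)

Renaming : Set
Renaming = ℕ → ℕ

renameTerm : Renaming → Term → Term
renameTerm σ (var x) = var x
renameTerm σ (par b) = par (σ b)

rename : Renaming → Formula → Formula
rename σ (atom p ts) = atom p (map (renameTerm σ) ts)
rename σ ⊥'          = ⊥'
rename σ (A ∧ B)     = rename σ A ∧ rename σ B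
rename σ (A ∨ B)     = rename σ A ∨ rename σ B
rename σ (A ⊃ B)     = rename σ A ⊃ rename σ B
rename σ (all x A)   = all x (rename σ A)
rename σ (ex x A)    = ex x (rename σ A)

renameTerm-substT : ∀ σ x a t → renameTerm σ (substT x a t) ≡ substT x (σ a) (renameTerm σ t)
renameTerm-substT σ x a (var y) with y ≟ x
... | yes _ = refl
... | no _  = refl
renameTerm-substT σ x a (par b) = refl

rename-[/] : ∀ σ A a x → rename σ (A [ a / x ]) ≡ rename σ A [ σ a / x ]
rename-[/] σ (atom p ts) a x =
  cong (atom p) (trans (sym (map-∘ ts)) (trans (map-cong (renameTerm-substT σ x a) ts) (map-∘ ts)))
rename-[/] σ ⊥'      a x = refl
rename-[/] σ (A ∧ B) a x = cong₂ _∧_ (rename-[/] σ A a x) (rename-[/] σ B a x)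
rename-[/] σ (A ∨ B) a x = cong₂ _∨_ (rename-[/] σ A a x) (rename-[/] σ B a x)
rename-[/] σ (A ⊃ B) a x = cong₂ _⊃_ (rename-[/] σ A a x) (rename-[/] σ B a x)
rename-[/] σ (all y A) a x with y ≟ x
... | yes _ = refl
... | no _  = cong (all y) (rename-[/] σ A a x)
rename-[/] σ (ex y A) a x with y ≟ x
... | yes _ = refl
... | no _  = cong (ex y) (rename-[/] σ A a x)

renameTerms-cong : ∀ {σ τ} ts → (∀ {b} → b ∈ concatMap paramsT ts → σ b ≡ τ b) →
                   map (renameTerm σ) ts ≡ map (renameTerm τ) ts
renameTerms-cong []           agree = refl
renameTerms-cong (var y ∷ ts) agree = cong (var y ∷_) (renameTerms-cong ts agree)
renameTerms-cong (par b ∷ ts) agree =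
  cong₂ _∷_ (cong par (agree (here refl))) (renameTerms-cong ts (agree ∘ there))

rename-cong : ∀ {σ τ} A → (∀ {b} → b ∈ params A → σ b ≡ τ b) → rename σ A ≡ rename τ A
rename-cong (atom p ts) agree = cong (atom p) (renameTerms-cong ts agree)
rename-cong ⊥'          agree = refl
rename-cong (A ∧ B)     agree =
  cong₂ _∧_ (rename-cong A (agree ∘ ∈-++⁺ˡ)) (rename-cong B (agree ∘ ∈-++⁺ʳ (params A)))
rename-cong (A ∨ B)     agree =
  cong₂ _∨_ (rename-cong A (agree ∘ ∈-++⁺ˡ)) (rename-cong B (agree ∘ ∈-++⁺ʳ (params A)))
rename-cong (A ⊃ B)     agree =
  cong₂ _⊃_ (rename-cong A (agree ∘ ∈-++⁺ˡ)) (rename-cong B (agree ∘ ∈-++⁺ʳ (params A)))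
rename-cong (all x A)   agree = cong (all x) (rename-cong A agree)
rename-cong (ex x A)    agree = cong (ex x) (rename-cong A agree)

renameTerm-id : ∀ t → renameTerm id t ≡ t
renameTerm-id (var x) = refl
renameTerm-id (par b) = refl

rename-id : ∀ A → rename id A ≡ A
rename-id (atom p ts) = cong (atom p) (trans (map-cong renameTerm-id ts) (map-id ts))
rename-id ⊥'          = refl
rename-id (A ∧ B)     = cong₂ _∧_ (rename-id A) (rename-id B)
rename-id (A ∨ B)     = cong₂ _∨_ (rename-id A) (rename-id B)
rename-id (A ⊃ B)     = cong₂ _⊃_ (rename-id A) (rename-id B)
rename-id (all x A)   = cong (all x) (rename-id A)
rename-id (ex x A)    = cong (ex x) (rename-id A)

map-rename-id : ∀ Γ → map (rename id) Γ ≡ Γ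
map-rename-id Γ = trans (map-cong rename-id Γ) (map-id Γ)

Fixes : Renaming → Formula → Set
Fixes σ A = ∀ {b} → b ∈ params A → σ b ≡ b

rename-fixed : ∀ {σ} A → Fixes σ A → rename σ A ≡ A
rename-fixed A fixed = trans (rename-cong A fixed) (rename-id A)

update : Renaming → ℕ → ℕ → Renaming
update σ e f b = if ⌊ b ≟ e ⌋ then f else σ b

update-≡ : ∀ σ e f → update σ e f e ≡ f
update-≡ σ e f with e ≟ e
... | yes _   = refl
... | no e≢e = contradiction refl e≢e

update-≢ : ∀ σ {e} f {b} → b ≢ e → update σ e f b ≡ σ b
update-≢ σ {e} f {b} b≢e with b ≟ e
... | yes b≡e = contradiction b≡e b≢e
... | no _    = refl

infix 4 _#_
_#_ : ℕ → Formula → Set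
e # A = e ∉ params A

Fresh : ℕ → Comp → Set
Fresh e c = All (e #_) (ante c) × All (e #_) (succ c)

rename-update : ∀ {σ e f A} → e # A → rename (update σ e f) A ≡ rename σ A
rename-update {σ} {f = f} {A} e#A = rename-cong A (λ b∈A → update-≢ σ f λ { refl → e#A b∈A })

map-rename-update : ∀ {σ e f Γ} → All (e #_) Γ →
                    map (rename (update σ e f)) Γ ≡ map (rename σ) Γ
map-rename-update fresh = map-cong-local (All.map rename-update fresh)

rename-update-[/] : ∀ {σ e f} A x → e # A →
                    rename (update σ e f) (A [ e / x ]) ≡ rename σ A [ f / x ]
rename-update-[/] {σ} {e} {f} A x e#A = begin
  rename (update σ e f) (A [ e / x ])             ≡⟨ rename-[/] (update σ e f) A e x ⟩
  rename (update σ e f) A [ update σ e f e / x ]  ≡⟨ cong₂ _[_/ x ] A-unchanged (update-≡ σ e f) ⟩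
  rename σ A [ f / x ]                            ∎
  where
  open ≡-Reasoning
  A-unchanged = rename-update {A = A} e#A

fixes-update : ∀ {σ e f A} → Fixes σ A → e # A → Fixes (update σ e f) A
fixes-update {σ} {f = f} fixed e#A b∈A = trans (update-≢ σ f λ { refl → e#A b∈A }) (fixed b∈A)

fresh : List ℕ → ℕ
fresh bs = suc (max 0 bs)

fresh-∉ : ∀ bs → fresh bs ∉ bs
fresh-∉ bs m = n≮n _ (All.lookup (xs≤max 0 bs) m)

fresh-component : ∀ {e} c → e ∉ paramsC c → Fresh e c
fresh-component (Γ ⊢ Δ) e∉ = ¬Any⇒All¬ Γ (e∉ ∘ ∈-++⁺ˡ ∘ ∈-concatMap⁺ params)
                          , ¬Any⇒All¬ Δ (e∉ ∘ ∈-++⁺ʳ _ ∘ ∈-concatMap⁺ params)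

fresh-focus : ∀ {e} G {c H} → e ∉ paramsLNS (G ++ c ∷ H) →
              All (Fresh e) G × Fresh e c × All (Fresh e) H
fresh-focus G e∉
  with ++⁻ G (All.map (fresh-component _) (¬Any⇒All¬ _ (e∉ ∘ ∈-concatMap⁺ paramsC)))
... | frG , frc ∷ frH = frG , frc , frH

to-front : ∀ {A : Set} {x : A} {xs} → x ∈ xs → ∃[ ys ] xs ↭ x ∷ ys
to-front {x = x} x∈xs with ∈-∃++ x∈xs
... | ys , zs , refl = ys ++ zs , shift x ys zs

∈-replicate⁻ : ∀ {A : Set} {x y : A} k → x ∈ replicate k y → ∃[ k' ] k ≡ suc k' × x ≡ y
∈-replicate⁻ (suc k) (here x≡y) = k , refl , x≡y
∈-replicate⁻ (suc k) (there x∈) with ∈-replicate⁻ k x∈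
... | _ , _ , x≡y = k , refl , x≡y

≈ₗ-refl : ∀ G → G ≈ₗ G
≈ₗ-refl G = Pointwise.refl (↭-refl , ↭-refl)

exchange : ∀ G H {Γ Γ' Δ Δ'} → Γ' ↭ Γ → Δ' ↭ Δ →
           LNIF (G ++ (Γ ⊢ Δ) ∷ H) → LNIF (G ++ (Γ' ⊢ Δ') ∷ H)
exchange G H Γ'↭Γ Δ'↭Δ = ex-perm (++⁺ (≈ₗ-refl G) ((↭-sym Γ'↭Γ , ↭-sym Δ'↭Δ) ∷ ≈ₗ-refl H))

lift-all : ∀ G H T {Γ₁ Δ₁ Γ₂ Δ₂} → LNIF (G ++ (T ++ Γ₁ ⊢ Δ₁) ∷ (T ++ Γ₂ ⊢ Δ₂) ∷ H) →
           LNIF (G ++ (T ++ Γ₁ ⊢ Δ₁) ∷ (Γ₂ ⊢ Δ₂) ∷ H)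
lift-all G H []      D = D
lift-all G H (C ∷ T) {Γ₁} {Δ₁} {Γ₂} {Δ₂} D =
  exchange G _ (↭-sym (shift C T Γ₁)) ↭-refl
    (lift-all G H T (exchange G _ (shift C T Γ₁) ↭-refl (lift G H (T ++ Γ₁) Δ₁ (T ++ Γ₂) Δ₂ C D)))

data Inversion : Formula → List Formula → Set where
  ∧-inv  : ∀ {A B} → Inversion (A ∧ B) (A ∷ B ∷ [])
  ∨-invˡ : ∀ {A B} → Inversion (A ∨ B) [ A ]
  ∨-invʳ : ∀ {A B} → Inversion (A ∨ B) [ B ]
  ⊃-inv  : ∀ {A B} → Inversion (A ⊃ B) [ B ]
  ∀-inv  : ∀ {x A} a → Inversion (all x A) (A [ a / x ] ∷ all x A ∷ [])
  ∃-inv  : ∀ {x A} a → Inversion (ex x A) [ A [ a / x ] ]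

Kept : Formula → List Formula → Formula → Set
Kept P T C = C ≡ P → C ∈ T

atom-kept : ∀ {P T p ts} → Inversion P T → Kept P T (atom p ts)
atom-kept () refl

⊥-kept : ∀ {P T} → Inversion P T → Kept P T ⊥'
⊥-kept () refl

∀-kept : ∀ {P T x A} → Inversion P T → Kept P T (all x A)
∀-kept (∀-inv a) refl = there (here refl)

_^^ₗ_ : List Formula → ℕ → List Formula
T ^^ₗ k = concat (replicate k T)

record Replaced (P : Formula) (T : List Formula) (σ : Renaming) (c c' : Comp) : Set where
  constructor replaced
  field
    context  : List Formula
    copies   : ℕ
    added    : List Formula
    ante-src : ante c ↭ context ++ P ^^ copies
    ante-tgt : ante c' ↭ map (rename σ) context ++ T ^^ₗ copies
    succ-tgt : succ c' ↭ map (rename σ) (succ c) ++ added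
    -- Only components still holding copies of P constrain σ, so an eigenvariable occurring
    -- in P can still be renamed once no copies are left.
    fixes    : 0 < copies → Fixes σ P
open Replaced

Replacement : Formula → List Formula → Renaming → LNS → LNS → Set
Replacement P T σ = Pointwise (Replaced P T σ)

module _ {P : Formula} {T : List Formula} where

  data Focus (σ : Renaming) (G : LNS) (c : Comp) (H : LNS) : LNS → Set where
    focused : ∀ G' c' H' → Replacement P T σ G G' → Replaced P T σ c c' → Replacement P T σ H H' →
              Focus σ G c H (G' ++ c' ∷ H')

  focus : ∀ {σ} G {c H G'} → Replacement P T σ (G ++ c ∷ H) G' → Focus σ G c H G'
  focus []      (r ∷ rs) = focused [] _ _ [] r rs
  focus (_ ∷ G) (r ∷ rs) with focus G rs
  ... | focused G' c' H' rG r₀ rH = focused (_ ∷ G') c' H' (r ∷ rG) r₀ rH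

  data Occurrence (σ : Renaming) (C : Formula) (Γ Δ : List Formula) (c' : Comp) : Set where
    in-context    : ∀ X → ante c' ↭ rename σ C ∷ X → Replaced P T σ (Γ ⊢ Δ) (X ⊢ succ c') →
                    Occurrence σ C Γ Δ c'
    replaced-copy : ∀ X → C ≡ P → Fixes σ P → ante c' ↭ T ++ X →
                    Replaced P T σ (Γ ⊢ Δ) (X ⊢ succ c') → Occurrence σ C Γ Δ c'

  occurrence : ∀ {σ C Γ Δ c'} → Replaced P T σ (C ∷ Γ ⊢ Δ) c' → Occurrence σ C Γ Δ c'
  occurrence {σ} {C} (replaced Γr k E src tgt stgt fixed) with ∈-++⁻ Γr (∈-resp-↭ src (here refl))
  ... | inj₁ C∈Γr with ∈-∃++ C∈Γr
  ...   | ys , zs , refl =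
    in-context _ (↭-trans tgt (++⁺ʳ _ (map⁺ (rename σ) (shift C ys zs))))
      (replaced (ys ++ zs) k E (drop-∷ (↭-trans src (++⁺ʳ _ (shift C ys zs)))) ↭-refl stgt fixed)
  occurrence {σ} (replaced Γr k E src tgt stgt fixed) | inj₂ C∈copies with ∈-replicate⁻ k C∈copies
  ... | k' , refl , refl =
    replaced-copy _ refl (fixed z<s) (↭-trans tgt (shifts (map (rename σ) Γr) T))
      (replaced Γr k' E (drop-∷ (↭-trans src (shift P Γr (P ^^ k')))) ↭-refl stgt (λ _ → fixed z<s))

  antecedent-∈ : ∀ {σ C Γ Δ c'} → Kept P T C → Replaced P T σ (C ∷ Γ ⊢ Δ) c' → rename σ C ∈ ante c'
  antecedent-∈ kept r with occurrence r
  ... | in-context _ ante↭ _ = ∈-resp-↭ (↭-sym ante↭) (here refl)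
  ... | replaced-copy _ refl fixed ante↭ _ =
    ∈-resp-↭ (↭-sym ante↭) (∈-++⁺ˡ (subst (_∈ T) (sym (rename-fixed P fixed)) (kept refl)))

  succedent-∈ : ∀ {σ C c c'} → Replaced P T σ c c' → C ∈ succ c → rename σ C ∈ succ c'
  succedent-∈ {σ} r C∈ = ∈-resp-↭ (↭-sym (succ-tgt r)) (∈-++⁺ˡ (∈-map⁺ (rename σ) C∈))

  Replacement-resp-≈ : ∀ {σ G₀ G G'} → G₀ ≈ₗ G → Replacement P T σ G G' → Replacement P T σ G₀ G'
  Replacement-resp-≈ [] [] = []
  Replacement-resp-≈ {σ} ((a , s) ∷ G₀≈G) (replaced Γr k E src tgt stgt fixed ∷ rs) =
    replaced Γr k E (↭-trans a src) tgt (↭-trans stgt (++⁺ʳ E (map⁺ (rename σ) (↭-sym s)))) fixed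
      ∷ Replacement-resp-≈ G₀≈G rs

  retarget : ∀ {σ c d d'} → ante d' ↭ ante d → succ d' ↭ succ d →
             Replaced P T σ c d → Replaced P T σ c d'
  retarget a s (replaced Γr k E src tgt stgt fixed) =
    replaced Γr k E src (↭-trans a tgt) (↭-trans s stgt) fixed

  extendˡ : ∀ {σ Γ Δ X Δ' Ms Y} Ns → map (rename σ) Ns ≡ Ms → Y ↭ Ms ++ X →
            Replaced P T σ (Γ ⊢ Δ) (X ⊢ Δ') → Replaced P T σ (Ns ++ Γ ⊢ Δ) (Y ⊢ Δ')
  extendˡ {σ} Ns refl Y↭ (replaced Γr k E src tgt stgt fixed) =
    replaced (Ns ++ Γr) k E
      (↭-trans (++⁺ˡ Ns src) (↭-reflexive (sym (++-assoc Ns Γr _))))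
      (↭-trans Y↭ (↭-trans (++⁺ˡ _ tgt) (↭-reflexive regroup)))
      stgt fixed
    where
    open ≡-Reasoning
    ρ = map (rename σ)
    regroup : ρ Ns ++ ρ Γr ++ T ^^ₗ k ≡ ρ (Ns ++ Γr) ++ T ^^ₗ k
    regroup = begin
      ρ Ns ++ ρ Γr ++ T ^^ₗ k    ≡⟨ ++-assoc (ρ Ns) (ρ Γr) (T ^^ₗ k) ⟨
      (ρ Ns ++ ρ Γr) ++ T ^^ₗ k  ≡⟨ cong (_++ T ^^ₗ k) (map-++ (rename σ) Ns Γr) ⟨
      ρ (Ns ++ Γr) ++ T ^^ₗ k    ∎

  extendʳ : ∀ {σ Γ Δ X Δ'} A → Replaced P T σ (Γ ⊢ Δ) (X ⊢ Δ') →
            Replaced P T σ (Γ ⊢ A ∷ Δ) (X ⊢ rename σ A ∷ Δ')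
  extendʳ A (replaced Γr k E src tgt stgt fixed) = replaced Γr k E src tgt (prep _ stgt) fixed

  with-succedent : ∀ {σ Γ Δ c' Δ₁ Δ₁'} (r : Replaced P T σ (Γ ⊢ Δ) c') → map (rename σ) Δ₁ ≡ Δ₁' →
                   Replaced P T σ (Γ ⊢ Δ₁) (ante c' ⊢ Δ₁' ++ added r)
  with-succedent (replaced Γr k E src tgt stgt fixed) refl = replaced Γr k E src tgt ↭-refl fixed

  renamed : ∀ {σ Γ Δ Γ' Δ'} → map (rename σ) Γ ≡ Γ' → map (rename σ) Δ ≡ Δ' →
            Replaced P T σ (Γ ⊢ Δ) (Γ' ⊢ Δ')
  renamed {Γ = Γ} refl refl =
    replaced Γ 0 [] (↭-reflexive (sym (++-identityʳ Γ))) (↭-reflexive (sym (++-identityʳ _)))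
      (↭-reflexive (sym (++-identityʳ _))) λ ()

  add-copy : ∀ {σ Γ Δ c'} → Fixes σ P → Replaced P T σ (Γ ⊢ Δ) c' →
             Replaced P T σ (P ∷ Γ ⊢ Δ) (T ++ ante c' ⊢ succ c')
  add-copy {σ} fixed (replaced Γr k E src tgt stgt _) =
    replaced Γr (suc k) E (↭-trans (prep P src) (↭-sym (shift P Γr (P ^^ k))))
      (↭-trans (++⁺ˡ T tgt) (shifts T (map (rename σ) Γr))) stgt λ _ → fixed

  update-Replaced : ∀ {σ e f c c'} → Fresh e c →
                    Replaced P T σ c c' → Replaced P T (update σ e f) c c'
  update-Replaced (fresh-ante , fresh-succ) (replaced Γr k E src tgt stgt fixed) =
    replaced Γr k E src
      (↭-trans tgt (↭-reflexive (cong (_++ _) (sym (map-rename-update fresh-context)))))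
      (↭-trans stgt (↭-reflexive (cong (_++ _) (sym (map-rename-update fresh-succ)))))
      λ 0<k → fixes-update {A = P} (fixed 0<k)
                (All.lookup fresh-ante (∈-resp-↭ (↭-sym src) (copy-∈ k 0<k)))
    where
    fresh-context = ++⁻ˡ Γr (All-resp-↭ src fresh-ante)
    copy-∈ : ∀ k → 0 < k → P ∈ Γr ++ P ^^ k
    copy-∈ (suc k) _ = ∈-++⁺ʳ Γr (here refl)

  update-Replacement : ∀ {σ e f G G'} → All (Fresh e) G → Replacement P T σ G G' →
                       Replacement P T (update σ e f) G G'
  update-Replacement []         []       = []
  update-Replacement (fr ∷ frs) (r ∷ rs) = update-Replaced fr r ∷ update-Replacement frs rs

Replaceable : Formula → List Formula → LNS → Set
Replaceable P T G = ∀ σ {G'} → Replacement P T σ G G' → LNIF G'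

private
  variable
    P : Formula
    T : List Formula

id₁-replaceable : Inversion P T → ∀ G {H p ts Γ Δ} →
                  Replaceable P T (G ++ (atom p ts ∷ Γ ⊢ atom p ts ∷ Δ) ∷ H)
id₁-replaceable inv G {p = p} {ts} σ r with focus G r
... | focused G' c' H' _ r₀ _
  with to-front (antecedent-∈ (atom-kept inv) r₀) | to-front (succedent-∈ r₀ (here refl))
...   | X , ante↭ | Y , succ↭ = exchange G' H' ante↭ succ↭ (id₁ G' H' p (map (renameTerm σ) ts) X Y)

id₂-replaceable : Inversion P T → ∀ G H {F p ts Γ₁ Δ₁ Γ₂ Δ₂} →
                  Replaceable P T (G ++ (atom p ts ∷ Γ₁ ⊢ Δ₁) ∷ H ++ (Γ₂ ⊢ atom p ts ∷ Δ₂) ∷ F)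
id₂-replaceable inv G H {p = p} {ts} σ r with focus G r
... | focused G' c₁' _ _ r₁ rHF with focus H rHF
...   | focused H' c₂' F' _ r₂ _
  with to-front (antecedent-∈ (atom-kept inv) r₁) | to-front (succedent-∈ r₂ (here refl))
...     | X , ante↭ | Y , succ↭ =
  ex-perm (++⁺ (≈ₗ-refl G') ((↭-sym ante↭ , ↭-refl)
                 ∷ ++⁺ (≈ₗ-refl H') ((↭-refl , ↭-sym succ↭) ∷ ≈ₗ-refl F')))
    (id₂ G' H' F' p (map (renameTerm σ) ts) X (succ c₁') (ante c₂') Y)

⊥l-replaceable : Inversion P T → ∀ G {H Γ Δ} → Replaceable P T (G ++ (⊥' ∷ Γ ⊢ Δ) ∷ H)
⊥l-replaceable inv G σ r with focus G r
... | focused G' c' H' _ r₀ _ with to-front (antecedent-∈ (⊥-kept inv) r₀)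
...   | X , ante↭ = exchange G' H' ante↭ ↭-refl (⊥l G' H' X (succ c'))

∧l-replaceable : Inversion P T → ∀ G {H Γ Δ A B} →
                 Replaceable P T (G ++ (A ∷ B ∷ Γ ⊢ Δ) ∷ H) →
                 Replaceable P T (G ++ (A ∧ B ∷ Γ ⊢ Δ) ∷ H)
∧l-replaceable inv G {A = A} {B} premise σ r with focus G r
... | focused G' c' H' rG r₀ rH with occurrence r₀
...   | in-context X ante↭ r₁ = exchange G' H' ante↭ ↭-refl
  (∧l G' H' X (succ c') (rename σ A) (rename σ B)
    (premise σ (++⁺ rG (extendˡ (A ∷ B ∷ []) refl ↭-refl r₁ ∷ rH))))
...   | replaced-copy _ refl fixed ante↭ r₁ with inv
...     | ∧-inv = premise σ (++⁺ rG (extendˡ (A ∷ B ∷ []) A,B-fixed ante↭ r₁ ∷ rH))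
  where
  A,B-fixed = cong₂ (λ A' B' → A' ∷ B' ∷ []) (rename-fixed A (fixed ∘ ∈-++⁺ˡ))
                                             (rename-fixed B (fixed ∘ ∈-++⁺ʳ (params A)))

∨l-replaceable : Inversion P T → ∀ G {H Γ Δ A B} →
                 Replaceable P T (G ++ (A ∷ Γ ⊢ Δ) ∷ H) → Replaceable P T (G ++ (B ∷ Γ ⊢ Δ) ∷ H) →
                 Replaceable P T (G ++ (A ∨ B ∷ Γ ⊢ Δ) ∷ H)
∨l-replaceable inv G {A = A} {B} premise₁ premise₂ σ r with focus G r
... | focused G' c' H' rG r₀ rH with occurrence r₀
...   | in-context X ante↭ r₁ = exchange G' H' ante↭ ↭-refl
  (∨l G' H' X (succ c') (rename σ A) (rename σ B)
    (premise₁ σ (++⁺ rG (extendˡ [ A ] refl ↭-refl r₁ ∷ rH)))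
    (premise₂ σ (++⁺ rG (extendˡ [ B ] refl ↭-refl r₁ ∷ rH))))
...   | replaced-copy _ refl fixed ante↭ r₁ with inv
...     | ∨-invˡ = premise₁ σ (++⁺ rG (extendˡ [ A ] A-fixed ante↭ r₁ ∷ rH))
  where A-fixed = cong [_] (rename-fixed A (fixed ∘ ∈-++⁺ˡ))
...     | ∨-invʳ = premise₂ σ (++⁺ rG (extendˡ [ B ] B-fixed ante↭ r₁ ∷ rH))
  where B-fixed = cong [_] (rename-fixed B (fixed ∘ ∈-++⁺ʳ (params A)))

⊃l-replaceable : Inversion P T → ∀ G {H Γ Δ A B} →
                 Replaceable P T (G ++ (B ∷ Γ ⊢ Δ) ∷ H) →
                 Replaceable P T (G ++ ((A ⊃ B) ∷ Γ ⊢ A ∷ Δ) ∷ H) →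
                 Replaceable P T (G ++ ((A ⊃ B) ∷ Γ ⊢ Δ) ∷ H)
⊃l-replaceable inv G {A = A} {B} premise₁ premise₂ σ r with focus G r
... | focused G' c' H' rG r₀ rH with occurrence r₀
...   | in-context X ante↭ r₁ = exchange G' H' ante↭ ↭-refl
  (⊃l G' H' X (succ c') (rename σ A) (rename σ B)
    (premise₁ σ (++⁺ rG (extendˡ [ B ] refl ↭-refl r₁ ∷ rH)))
    (premise₂ σ (++⁺ rG (extendʳ A (extendˡ [ A ⊃ B ] refl ↭-refl r₁) ∷ rH))))
...   | replaced-copy _ refl fixed ante↭ r₁ with inv
...     | ⊃-inv = premise₁ σ (++⁺ rG (extendˡ [ B ] B-fixed ante↭ r₁ ∷ rH))
  where B-fixed = cong [_] (rename-fixed B (fixed ∘ ∈-++⁺ʳ (params A)))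

∀l-replaceable : Inversion P T → ∀ G {H Γ Δ x A b} →
                 Replaceable P T (G ++ (A [ b / x ] ∷ all x A ∷ Γ ⊢ Δ) ∷ H) →
                 Replaceable P T (G ++ (all x A ∷ Γ ⊢ Δ) ∷ H)
∀l-replaceable inv G {x = x} {A} {b} premise σ r with focus G r
... | focused G' c' H' rG r₀ rH with to-front (antecedent-∈ (∀-kept inv) r₀)
...   | X , ante↭ = exchange G' H' ante↭ ↭-refl
  (∀l G' H' X (succ c') x (rename σ A) (σ b)
    (premise σ (++⁺ rG (extendˡ [ A [ b / x ] ] Ab-renamed (prep _ (↭-sym ante↭)) r₀ ∷ rH))))
  where Ab-renamed = cong [_] (rename-[/] σ A b x)

∃l-replaceable : Inversion P T → ∀ G {H Γ Δ x A e} → e ∉ paramsLNS (G ++ (ex x A ∷ Γ ⊢ Δ) ∷ H) →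
                 Replaceable P T (G ++ (A [ e / x ] ∷ Γ ⊢ Δ) ∷ H) →
                 Replaceable P T (G ++ (ex x A ∷ Γ ⊢ Δ) ∷ H)
∃l-replaceable inv G {x = x} {A} {e} e-fresh premise σ r with focus G r | fresh-focus G e-fresh
... | focused G' c' H' rG r₀ rH | frG , (e#A ∷ frΓ , frΔ) , frH with occurrence r₀
...   | in-context X ante↭ r₁ = exchange G' H' ante↭ ↭-refl
  (∃l G' H' X (succ c') x (rename σ A) f (fresh-∉ (paramsLNS conclusion))
    (premise (update σ e f)
      (++⁺ (update-Replacement frG rG)
        (extendˡ [ A [ e / x ] ] Ae↦Af ↭-refl (update-Replaced (frΓ , frΔ) r₁)
          ∷ update-Replacement frH rH))))
  where
  conclusion = G' ++ (ex x (rename σ A) ∷ X ⊢ succ c') ∷ H'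
  f = fresh (paramsLNS conclusion)
  Ae↦Af = cong [_] (rename-update-[/] A x e#A)
...   | replaced-copy _ refl fixed ante↭ r₁ with inv
...     | ∃-inv a = premise (update σ e a)
  (++⁺ (update-Replacement frG rG)
    (extendˡ [ A [ e / x ] ] Ae↦Aa ante↭ (update-Replaced (frΓ , frΔ) r₁)
      ∷ update-Replacement frH rH))
  where
  Ae↦Aa = cong [_] (trans (rename-update-[/] A x e#A) (cong (_[ a / x ]) (rename-fixed A fixed)))

lift-replaceable : ∀ G {H Γ₁ Δ₁ Γ₂ Δ₂ A} →
                   Replaceable P T (G ++ (A ∷ Γ₁ ⊢ Δ₁) ∷ (A ∷ Γ₂ ⊢ Δ₂) ∷ H) →
                   Replaceable P T (G ++ (A ∷ Γ₁ ⊢ Δ₁) ∷ (Γ₂ ⊢ Δ₂) ∷ H)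
lift-replaceable {T = T} G {A = A} premise σ r with focus G r
... | focused G' c₁' (c₂' ∷ H') rG r₁ (r₂ ∷ rH) with occurrence r₁
...   | in-context X ante↭ r₁' = exchange G' (c₂' ∷ H') ante↭ ↭-refl
  (lift G' H' X (succ c₁') (ante c₂') (succ c₂') (rename σ A)
    (premise σ (++⁺ rG (extendˡ [ A ] refl ↭-refl r₁' ∷ extendˡ [ A ] refl ↭-refl r₂ ∷ rH))))
...   | replaced-copy _ refl fixed ante↭ _ = exchange G' (c₂' ∷ H') ante↭ ↭-refl
  (lift-all G' H' T
    (premise σ (++⁺ rG (retarget (↭-sym ante↭) ↭-refl r₁ ∷ add-copy fixed r₂ ∷ rH))))

∧r-replaceable : ∀ G {H Γ Δ A B} →
                 Replaceable P T (G ++ (Γ ⊢ A ∷ Δ) ∷ H) → Replaceable P T (G ++ (Γ ⊢ B ∷ Δ) ∷ H) →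
                 Replaceable P T (G ++ (Γ ⊢ A ∧ B ∷ Δ) ∷ H)
∧r-replaceable G {Δ = Δ} {A} {B} premise₁ premise₂ σ r with focus G r
... | focused G' c' H' rG r₀ rH = exchange G' H' ↭-refl (succ-tgt r₀)
  (∧r G' H' (ante c') (map (rename σ) Δ ++ added r₀) (rename σ A) (rename σ B)
    (premise₁ σ (++⁺ rG (with-succedent r₀ refl ∷ rH)))
    (premise₂ σ (++⁺ rG (with-succedent r₀ refl ∷ rH))))

∨r-replaceable : ∀ G {H Γ Δ A B} →
                 Replaceable P T (G ++ (Γ ⊢ A ∷ B ∷ Δ) ∷ H) →
                 Replaceable P T (G ++ (Γ ⊢ A ∨ B ∷ Δ) ∷ H)
∨r-replaceable G {Δ = Δ} {A} {B} premise σ r with focus G r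
... | focused G' c' H' rG r₀ rH = exchange G' H' ↭-refl (succ-tgt r₀)
  (∨r G' H' (ante c') (map (rename σ) Δ ++ added r₀) (rename σ A) (rename σ B)
    (premise σ (++⁺ rG (with-succedent r₀ refl ∷ rH))))

⊃r₁-replaceable : ∀ G {Γ Δ A B} →
                  Replaceable P T (G ++ (Γ ⊢ Δ) ∷ ([ A ] ⊢ [ B ]) ∷ []) →
                  Replaceable P T (G ++ (Γ ⊢ (A ⊃ B) ∷ Δ) ∷ [])
⊃r₁-replaceable G {Δ = Δ} {A} {B} premise σ r with focus G r
... | focused G' c' [] rG r₀ [] = exchange G' [] ↭-refl (succ-tgt r₀)
  (⊃r₁ G' (ante c') (map (rename σ) Δ ++ added r₀) (rename σ A) (rename σ B)
    (premise σ (++⁺ rG (with-succedent r₀ refl ∷ renamed refl refl ∷ []))))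

⊃r₂-replaceable : ∀ G {H Γ₁ Δ₁ Γ₂ Δ₂ A B} →
                  Replaceable P T (G ++ (Γ₁ ⊢ Δ₁) ∷ ([ A ] ⊢ [ B ]) ∷ (Γ₂ ⊢ Δ₂) ∷ H) →
                  Replaceable P T (G ++ (Γ₁ ⊢ Δ₁) ∷ (Γ₂ ⊢ (A ⊃ B) ∷ Δ₂) ∷ H) →
                  Replaceable P T (G ++ (Γ₁ ⊢ (A ⊃ B) ∷ Δ₁) ∷ (Γ₂ ⊢ Δ₂) ∷ H)
⊃r₂-replaceable G {Δ₁ = Δ₁} {A = A} {B} premise₁ premise₂ σ r with focus G r
... | focused G' c₁' (c₂' ∷ H') rG r₁ (r₂ ∷ rH) = exchange G' (c₂' ∷ H') ↭-refl (succ-tgt r₁)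
  (⊃r₂ G' H' (ante c₁') (map (rename σ) Δ₁ ++ added r₁) (ante c₂') (succ c₂')
    (rename σ A) (rename σ B)
    (premise₁ σ (++⁺ rG (with-succedent r₁ refl ∷ renamed refl refl ∷ r₂ ∷ rH)))
    (premise₂ σ (++⁺ rG (with-succedent r₁ refl ∷ extendʳ (A ⊃ B) r₂ ∷ rH))))

∃r-replaceable : ∀ G {H Γ Δ x A b} →
                 Replaceable P T (G ++ (Γ ⊢ A [ b / x ] ∷ ex x A ∷ Δ) ∷ H) →
                 Replaceable P T (G ++ (Γ ⊢ ex x A ∷ Δ) ∷ H)
∃r-replaceable G {Δ = Δ} {x} {A} {b} premise σ r with focus G r
... | focused G' c' H' rG r₀ rH = exchange G' H' ↭-refl (succ-tgt r₀)
  (∃r G' H' (ante c') (map (rename σ) Δ ++ added r₀) x (rename σ A) (σ b)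
    (premise σ (++⁺ rG (with-succedent r₀ (cong (_∷ _) (rename-[/] σ A b x)) ∷ rH))))

∀r₁-replaceable : ∀ G {Γ Δ x A e} → e ∉ paramsLNS (G ++ (Γ ⊢ all x A ∷ Δ) ∷ []) →
                  Replaceable P T (G ++ (Γ ⊢ Δ) ∷ ([] ⊢ [ A [ e / x ] ]) ∷ []) →
                  Replaceable P T (G ++ (Γ ⊢ all x A ∷ Δ) ∷ [])
∀r₁-replaceable G {Δ = Δ} {x} {A} {e} e-fresh premise σ r with focus G r | fresh-focus G e-fresh
... | focused G' c' [] rG r₀ [] | frG , (frΓ , e#A ∷ frΔ) , [] = exchange G' [] ↭-refl (succ-tgt r₀)
  (∀r₁ G' (ante c') Δ' x (rename σ A) f (fresh-∉ (paramsLNS conclusion))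
    (premise (update σ e f)
      (++⁺ (update-Replacement frG rG)
        (update-Replaced (frΓ , frΔ) (with-succedent r₀ refl)
          ∷ renamed refl (cong [_] (rename-update-[/] A x e#A)) ∷ []))))
  where
  Δ' = map (rename σ) Δ ++ added r₀
  conclusion = G' ++ (ante c' ⊢ all x (rename σ A) ∷ Δ') ∷ []
  f = fresh (paramsLNS conclusion)

∀r₂-replaceable : ∀ G {H Γ₁ Δ₁ Γ₂ Δ₂ x A e} →
                  e ∉ paramsLNS (G ++ (Γ₁ ⊢ all x A ∷ Δ₁) ∷ (Γ₂ ⊢ Δ₂) ∷ H) →
                  Replaceable P T (G ++ (Γ₁ ⊢ Δ₁) ∷ ([] ⊢ [ A [ e / x ] ]) ∷ (Γ₂ ⊢ Δ₂) ∷ H) →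
                  Replaceable P T (G ++ (Γ₁ ⊢ Δ₁) ∷ (Γ₂ ⊢ all x A ∷ Δ₂) ∷ H) →
                  Replaceable P T (G ++ (Γ₁ ⊢ all x A ∷ Δ₁) ∷ (Γ₂ ⊢ Δ₂) ∷ H)
∀r₂-replaceable G {Δ₁ = Δ₁} {x = x} {A} {e} e-fresh premise₁ premise₂ σ r
  with focus G r | fresh-focus G e-fresh
... | focused G' c₁' (c₂' ∷ H') rG r₁ (r₂ ∷ rH) | frG , (frΓ₁ , e#A ∷ frΔ₁) , fr₂ ∷ frH =
  exchange G' (c₂' ∷ H') ↭-refl (succ-tgt r₁)
  (∀r₂ G' H' (ante c₁') Δ₁' (ante c₂') (succ c₂') x (rename σ A) f (fresh-∉ (paramsLNS conclusion))
    (premise₁ (update σ e f)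
      (++⁺ (update-Replacement frG rG)
        (update-Replaced (frΓ₁ , frΔ₁) (with-succedent r₁ refl)
          ∷ renamed refl (cong [_] (rename-update-[/] A x e#A))
          ∷ update-Replaced fr₂ r₂ ∷ update-Replacement frH rH)))
    (premise₂ σ (++⁺ rG (with-succedent r₁ refl ∷ extendʳ (all x A) r₂ ∷ rH))))
  where
  Δ₁' = map (rename σ) Δ₁ ++ added r₁
  conclusion = G' ++ (ante c₁' ⊢ all x (rename σ A) ∷ Δ₁') ∷ (ante c₂' ⊢ succ c₂') ∷ H'
  f = fresh (paramsLNS conclusion)

replaceable : ∀ {G} → Inversion P T → LNIF G → Replaceable P T G
replaceable inv (ex-perm G₀≈G D) σ r = replaceable inv D σ (Replacement-resp-≈ G₀≈G r)
replaceable inv (id₁ G _ _ _ _ _) = id₁-replaceable inv G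
replaceable inv (id₂ G H _ _ _ _ _ _ _) = id₂-replaceable inv G H
replaceable inv (⊥l G _ _ _) = ⊥l-replaceable inv G
replaceable inv (∧l G _ _ _ _ _ D) = ∧l-replaceable inv G (replaceable inv D)
replaceable inv (∨l G _ _ _ _ _ D₁ D₂) =
  ∨l-replaceable inv G (replaceable inv D₁) (replaceable inv D₂)
replaceable inv (⊃l G _ _ _ _ _ D₁ D₂) =
  ⊃l-replaceable inv G (replaceable inv D₁) (replaceable inv D₂)
replaceable inv (∀l G _ _ _ _ _ _ D) = ∀l-replaceable inv G (replaceable inv D)
replaceable inv (∃l G _ _ _ _ _ _ e-fresh D) = ∃l-replaceable inv G e-fresh (replaceable inv D)
replaceable inv (lift G _ _ _ _ _ _ D) = lift-replaceable G (replaceable inv D)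
replaceable inv (∧r G _ _ _ _ _ D₁ D₂) =
  ∧r-replaceable G (replaceable inv D₁) (replaceable inv D₂)
replaceable inv (∨r G _ _ _ _ _ D) = ∨r-replaceable G (replaceable inv D)
replaceable inv (⊃r₁ G _ _ _ _ D) = ⊃r₁-replaceable G (replaceable inv D)
replaceable inv (⊃r₂ G _ _ _ _ _ _ _ D₁ D₂) =
  ⊃r₂-replaceable G (replaceable inv D₁) (replaceable inv D₂)
replaceable inv (∃r G _ _ _ _ _ _ D) = ∃r-replaceable G (replaceable inv D)
replaceable inv (∀r₁ G _ _ _ _ _ e-fresh D) = ∀r₁-replaceable G e-fresh (replaceable inv D)
replaceable inv (∀r₂ G _ _ _ _ _ _ _ _ e-fresh D₁ D₂) =
  ∀r₂-replaceable G e-fresh (replaceable inv D₁) (replaceable inv D₂)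

replace-copies : ∀ {L} → (∀ k → L k ↭ T ^^ₗ k) → ∀ S →
                 Replacement P T id (build (P ^^_) none S) (build L none S)
replace-copies L↭ [] = []
replace-copies L↭ ((Γ , Δ , k) ∷ S) =
  replaced Γ k [] ↭-refl
    (↭-trans (++⁺ˡ Γ (L↭ k)) (↭-reflexive (cong (_++ _) (sym (map-rename-id Γ)))))
    (↭-reflexive (sym (trans (++-identityʳ _) (map-rename-id _))))
    (λ _ _ → refl)
  ∷ replace-copies L↭ S

weaken-succedents : ∀ L R S → Replacement P T id (build L none S) (build L R S)
weaken-succedents L R [] = []
weaken-succedents L R ((Γ , Δ , k) ∷ S) =
  replaced (Γ ++ L k) 0 (R k)
    (↭-reflexive (sym (++-identityʳ _)))
    (↭-reflexive (sym (trans (++-identityʳ _) (map-rename-id _))))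
    (↭-reflexive (cong (_++ R k) (sym (trans (map-rename-id _) (++-identityʳ Δ)))))
    (λ ())
  ∷ weaken-succedents L R S

^^-singleton : ∀ C k → C ^^ k ↭ [ C ] ^^ₗ k
^^-singleton C zero    = ↭-refl
^^-singleton C (suc k) = prep C (^^-singleton C k)

^^-pair : ∀ C D k → C ^^ k ++ D ^^ k ↭ (C ∷ D ∷ []) ^^ₗ k
^^-pair C D zero    = ↭-refl
^^-pair C D (suc k) = prep C (↭-trans (shift D (C ^^ k) (D ^^ k)) (prep D (^^-pair C D k)))

lemma8 : (S : Spec) (A B : Formula) (x a : ℕ) → 1 ≤ totalK S →
    ((ClosedLNS (build (λ k → (A ∧ B) ^^ k) none S) →
      LNIF (build (λ k → (A ∧ B) ^^ k) none S) →
      LNIF (build (λ k → (A ^^ k) ++ (B ^^ k)) none S))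
    × (ClosedLNS (build (λ k → (A ∨ B) ^^ k) none S) →
      LNIF (build (λ k → (A ∨ B) ^^ k) none S) →
      LNIF (build (λ k → A ^^ k) none S) × LNIF (build (λ k → B ^^ k) none S))
    × (ClosedLNS (build (λ k → (A ⊃ B) ^^ k) none S) →
      LNIF (build (λ k → (A ⊃ B) ^^ k) none S) →
      LNIF (build (λ k → B ^^ k) none S)
        × LNIF (build (λ k → (A ⊃ B) ^^ k) (λ k → A ^^ k) S))
    × (ClosedLNS (build (λ k → all x A ^^ k) none S) →
      LNIF (build (λ k → all x A ^^ k) none S) →
      LNIF (build (λ k → ((A [ a / x ]) ^^ k) ++ (all x A ^^ k)) none S))
    × (ClosedLNS (build (λ k → ex x A ^^ k) none S) →
      LNIF (build (λ k → ex x A ^^ k) none S) →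
      LNIF (build (λ k → (A [ a / x ]) ^^ k) none S)))
lemma8 S A B x a _ =
    (λ _ D → replaceable ∧-inv D id (replace-copies (^^-pair A B) S))
  , (λ _ D → replaceable ∨-invˡ D id (replace-copies (^^-singleton A) S)
           , replaceable ∨-invʳ D id (replace-copies (^^-singleton B) S))
  , (λ _ D → replaceable ⊃-inv D id (replace-copies (^^-singleton B) S)
           , replaceable (⊃-inv {A} {B}) D id (weaken-succedents ((A ⊃ B) ^^_) (A ^^_) S))
  , (λ _ D → replaceable (∀-inv a) D id (replace-copies (^^-pair (A [ a / x ]) (all x A)) S))
  , (λ _ D → replaceable (∃-inv a) D id (replace-copies (^^-singleton (A [ a / x ])) S))
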